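{- Let $X$ be a graph, let $p\colon Y\to X$ and $p'\colon Y'\to X$ be covering maps, and let $f\colon Y\to Y'$ be a graph map with $p'\circ f=p$. Then $f\colon Y\to Y'$ is itself a covering map.
   Context: Graphs are simple undirected loopless graphs; graph maps send adjacent vertices to equal or adjacent vertices. $I_n$ has vertices $0,\dots,n$, edges $i\sim i+1$; $I_1\square I_1$ is the $4$-cycle with vertex set $\{0,1\}^2$, two vertices adjacent iff they differ in exactly one coordinate. A graph map $q\colon B\to A$ is a covering map if (i) for every vertex $b$ of $B$, $q$ restricts to a bijection from the set consisting of $b$ and its neighbours onto the set consisting of $q(b)$ and its neighbours, and (ii) for all graph maps $u\colon I_3\to B$ and $v\colon I_1\square I_1\to A$ with $q(u(0))=v(1,0)$, $q(u(1))=v(0,0)$, $q(u(2))=v(0,1)$, $q(u(3))=v(1,1)$, one has $u(0)=u(3)$ or $u(0)\sim u(3)$. -}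

module Defs where

open import Level using (Level; _⊔_; 0ℓ)
open import Data.Nat using (ℕ; zero; suc)
import Data.Nat.Properties
open import Data.Fin using (Fin; toℕ)
open import Data.Bool using (Bool; true; false)
open import Data.Product using (Σ; ∃; _×_; _,_; proj₁)
open import Data.Sum using (_⊎_)
open import Data.Empty using (⊥)
open import Relation.Nullary using (¬_)
open import Relation.Binary.PropositionalEquality using (_≡_)

record Graph (v e : Level) : Set (Level.suc (v ⊔ e)) where
  field
    V     : Set v
    _~_   : V → V → Set e
    sym~  : ∀ {x y} → x ~ y → y ~ x
    irr~  : ∀ {x} → ¬ (x ~ x)
open Graph public

_≃~_ : ∀ {v e} (G : Graph v e) → V G → V G → Set (v ⊔ e)
G ≃~ x = λ y → (x ≡ y) ⊎ (_~_ G x y)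

record GraphMap {v e v' e'} (G : Graph v e) (H : Graph v' e')
       : Set (v ⊔ e ⊔ v' ⊔ e') where
  field
    fun  : V G → V H
    pres : ∀ {x y} → _~_ G x y → (H ≃~ fun x) (fun y)
open GraphMap public

I : ℕ → Graph 0ℓ 0ℓ
I n = record
  { V = Fin (suc n)
  ; _~_ = λ i j → (suc (toℕ i) ≡ toℕ j) ⊎ (suc (toℕ j) ≡ toℕ i)
  ; sym~ = λ { (Data.Sum.inj₁ p) → Data.Sum.inj₂ p ; (Data.Sum.inj₂ p) → Data.Sum.inj₁ p }
  ; irr~ = λ { (Data.Sum.inj₁ p) → n≢sn p ; (Data.Sum.inj₂ p) → n≢sn p }
  }
  where
  n≢sn : ∀ {m : ℕ} → ¬ (suc m ≡ m)
  n≢sn {m} p = Data.Nat.Properties.<-irrefl (Relation.Binary.PropositionalEquality.sym p) (Data.Nat.Properties.n<1+n m)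

_≢ᵇ_ : Bool → Bool → Set
x ≢ᵇ y = ¬ (x ≡ y)

-- I_1 □ I_1 : the 4-cycle on {0,1}², adjacent iff exactly one coordinate differs
Square : Graph 0ℓ 0ℓ
Square = record
  { V = Bool × Bool
  ; _~_ = λ { (a , b) (c , d) → ((a ≢ᵇ c) × (b ≡ d)) ⊎ ((a ≡ c) × (b ≢ᵇ d)) }
  ; sym~ = λ { (Data.Sum.inj₁ (p , q)) → Data.Sum.inj₁ ((λ r → p (Relation.Binary.PropositionalEquality.sym r)) , Relation.Binary.PropositionalEquality.sym q)
             ; (Data.Sum.inj₂ (p , q)) → Data.Sum.inj₂ (Relation.Binary.PropositionalEquality.sym p , (λ r → q (Relation.Binary.PropositionalEquality.sym r))) }
  ; irr~ = λ { (Data.Sum.inj₁ (p , _)) → p Relation.Binary.PropositionalEquality.refl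
             ; (Data.Sum.inj₂ (_ , q)) → q Relation.Binary.PropositionalEquality.refl }
  }

-- vertices of I_3 and of the square, with 0 ↦ false, 1 ↦ true
i0 i1 i2 i3 : Fin 4
i0 = Data.Fin.zero
i1 = Data.Fin.suc Data.Fin.zero
i2 = Data.Fin.suc (Data.Fin.suc Data.Fin.zero)
i3 = Data.Fin.suc (Data.Fin.suc (Data.Fin.suc Data.Fin.zero))

-- Covering map q : B → A.
-- (i) for every b, q restricts to a bijection from the closed neighbourhood
--     N[b] = {b} ∪ nbrs(b) onto N[q b]  (stated as injective + surjective)
-- (ii) the 4-cycle lifting condition.
record IsCovering {v e v' e'} {B : Graph v e} {A : Graph v' e'}
       (q : GraphMap B A) : Set (v ⊔ e ⊔ v' ⊔ e') where
  field
    locInj  : ∀ (b x y : V B) → (B ≃~ b) x → (B ≃~ b) y →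
              fun q x ≡ fun q y → x ≡ y
    locSurj : ∀ (b : V B) (a : V A) → (A ≃~ fun q b) a →
              Σ (V B) λ x → (B ≃~ b) x × (fun q x ≡ a)
    square  : ∀ (u : GraphMap (I 3) B) (w : GraphMap Square A) →
              fun q (fun u i0) ≡ fun w (true  , false) →
              fun q (fun u i1) ≡ fun w (false , false) →
              fun q (fun u i2) ≡ fun w (false , true) →
              fun q (fun u i3) ≡ fun w (true  , true) →
              (B ≃~ fun u i0) (fun u i3)

module Submission where

-- Write r = q ∘ f with r a covering. Local injectivity and the square condition
-- pass from r to f for any graph map q, since a collision or a square for f is
-- pushed forward by q to one for r. For local surjectivity at y, lift q(x) through
-- r to some z near y; then f z and x both lie in the closed neighbourhood of f y
-- and have the same image under q, so local injectivity of q gives f z = x.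

open import Defs
open import Level using (Level)
open import Relation.Binary.PropositionalEquality using (_≡_; sym; trans; cong; subst)
open import Data.Sum using (inj₁; inj₂)
open import Data.Product using (Σ; _×_; _,_)
open import Data.Bool using (true; false)

module _ {a b c d : Level} {G : Graph a b} {H : Graph c d} (f : GraphMap G H) where

  pres-≃~ : ∀ {x y} → (G ≃~ x) y → (H ≃~ fun f x) (fun f y)
  pres-≃~ (inj₁ x≡y) = inj₁ (cong (fun f) x≡y)
  pres-≃~ (inj₂ x~y) = pres f x~y

_∘ᴳ_ : ∀ {a b c d e g : Level} {G : Graph a b} {H : Graph c d} {K : Graph e g} →
       GraphMap H K → GraphMap G H → GraphMap G K
q ∘ᴳ f = record { fun = λ x → fun q (fun f x) ; pres = λ x~y → pres-≃~ q (pres f x~y) }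

module _ {a b c d e g : Level} {X : Graph a b} {Y : Graph c d} {Y' : Graph e g}
         (r : GraphMap Y X) (q : GraphMap Y' X) (f : GraphMap Y Y')
         (q∘f≗r : ∀ y → fun q (fun f y) ≡ fun r y) (cov-r : IsCovering r) where

  open IsCovering cov-r

  private
    r-over : ∀ {y x} → fun f y ≡ x → fun r y ≡ fun q x
    r-over {y} fy≡x = trans (sym (q∘f≗r y)) (cong (fun q) fy≡x)

  locInj-cancelˡ : ∀ (y z w : V Y) → (Y ≃~ y) z → (Y ≃~ y) w →
                   fun f z ≡ fun f w → z ≡ w
  locInj-cancelˡ y z w y≃z y≃w fz≡fw =
    locInj y z w y≃z y≃w (trans (r-over fz≡fw) (q∘f≗r w))

  square-cancelˡ : ∀ (u : GraphMap (I 3) Y) (v : GraphMap Square Y') →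
    fun f (fun u i0) ≡ fun v (true  , false) →
    fun f (fun u i1) ≡ fun v (false , false) →
    fun f (fun u i2) ≡ fun v (false , true) →
    fun f (fun u i3) ≡ fun v (true  , true) →
    (Y ≃~ fun u i0) (fun u i3)
  square-cancelˡ u v e0 e1 e2 e3 =
    square u (q ∘ᴳ v) (r-over e0) (r-over e1) (r-over e2) (r-over e3)

  locSurj-cancelˡ : IsCovering q →
    ∀ (y : V Y) (x : V Y') → (Y' ≃~ fun f y) x →
    Σ (V Y) λ z → (Y ≃~ y) z × (fun f z ≡ x)
  locSurj-cancelˡ cov-q y x fy≃x
    with locSurj y (fun q x) (subst (λ t → (X ≃~ t) (fun q x)) (q∘f≗r y) (pres-≃~ q fy≃x))
  ... | z , y≃z , rz≡qx =
    z , y≃z , IsCovering.locInj cov-q (fun f y) (fun f z) x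
                (pres-≃~ f y≃z) fy≃x (trans (q∘f≗r z) rz≡qx)

proposition4p17 : ∀ {a b c d e g : Level}
    {X : Graph a b} {Y : Graph c d} {Y' : Graph e g}
    (p : GraphMap Y X) (p' : GraphMap Y' X) (f : GraphMap Y Y') →
    IsCovering p → IsCovering p' →
    (∀ y → fun p' (fun f y) ≡ fun p y) →
    IsCovering f
proposition4p17 p p' f cov-p cov-p' p'∘f≗p = record
  { locInj  = locInj-cancelˡ p p' f p'∘f≗p cov-p
  ; locSurj = locSurj-cancelˡ p p' f p'∘f≗p cov-p cov-p'
  ; square  = square-cancelˡ p p' f p'∘f≗p cov-p
  }
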